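{- $\lim_{n\to\infty} f(n)=\infty$.
   Context: For a positive integer $n$, $T_n$ denotes the triangular lattice with $n$ rows: the set of points $\{a(1,0)+b(\tfrac12,\tfrac{\sqrt3}{2}) : a,b\in\mathbb{Z}_{\ge 0},\ a+b\le n-1\}$ in the plane. A proper coloring of $T_n$ is an assignment of colors to the points of $T_n$ such that no three points of $T_n$ that are the vertices of an equilateral triangle (of any size and any orientation) all receive the same color. $f(n)$ denotes the minimum number of colors in a proper coloring of $T_n$. -}

module Defs where

open import Data.Nat using (ℕ)
open import Data.Integer using (ℤ; +_; _+_; _-_; _≤_; _<_)
open import Data.Fin using (Fin)
open import Data.Product using (_×_)
open import Relation.Binary.PropositionalEquality using (_≡_)
open import Relation.Nullary using (¬_)

-- A point a·(1,0) + b·(1/2, √3/2) is represented by its lattice coordinates (a , b) ∈ ℤ².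
-- InT n a b : the point (a , b) lies in T_n, i.e. a, b ≥ 0 and a + b ≤ n - 1.
InT : ℕ → ℤ → ℤ → Set
InT n a b = (+ 0 ≤ a) × (+ 0 ≤ b) × (a + b < + n)

-- Rotation by +60° in lattice coordinates: e₁ ↦ e₂, e₂ ↦ e₂ - e₁,
-- so x e₁ + y e₂ ↦ (- y) e₁ + (x + y) e₂.
-- Every equilateral triangle (any size, any orientation) with vertices in the
-- plane is {P, P + v, P + rot60 v} for some P and nonzero v (list its vertices
-- counterclockwise).  Here P = (a , b), v = (x , y).

-- A coloring of T_n with k colors (given on all of ℤ², only values on T_n matter).
Coloring : ℕ → Set
Coloring k = ℤ → ℤ → Fin k

Proper : (n k : ℕ) → Coloring k → Set
Proper n k c =
  ∀ (a b x y : ℤ) → ¬ ((x ≡ + 0) × (y ≡ + 0)) →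
  InT n a b → InT n (a + x) (b + y) → InT n (a - y) (b + x + y) →
  ¬ ((c a b ≡ c (a + x) (b + y)) × (c a b ≡ c (a - y) (b + x + y)))

{-# OPTIONS --safe #-}
-- Color focusing, as in the proof of Gallai's theorem for corners.  Call r spokes from an apex
-- (a , b) focused if every spoke s has equally colored ends (a + s , b) and (a , b + s), and the
-- r spokes carry pairwise different colors.  By induction on r, every k-coloring of a large enough
-- square contains a monochromatic corner or r focused spokes: cut a larger square into n × n boxes;
-- by pigeonhole two boxes on an antidiagonal, at (α + Δ , β) and (α , β + Δ), are colored
-- identically.  A focus inside the first either closes a corner at its own apex, or, moved to the
-- box at (α , β), gains a new spoke of length Δ.  As k colors admit at most k focused spokes,
-- r = k + 1 forces a monochromatic corner, and in lattice coordinates a corner is an equilateral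
-- triangle.
module Submission where

open import Defs
open import Data.Nat using (ℕ; _≤_; zero; suc; _+_; _*_; _∸_; _^_; _<_; z≤n; s≤s⁻¹; z<s)
open import Data.Product using (Σ; ∃-syntax; _×_; _,_; ∃₂)
open import Relation.Nullary using (¬_; yes; no)
open import Data.Nat.Properties
open import Algebra.Properties.CommutativeSemigroup +-commutativeSemigroup using (interchange)
open import Data.Fin as Fin using (Fin; toℕ; fromℕ<; funToFin)
open import Data.Fin.Properties using (pigeonhole; injective⇒≤; finToFun-funToFin; toℕ<n; toℕ-fromℕ<; any?)
open import Data.Vec.Functional using (_∷_)
open import Data.Integer using (+_; +≤+; +<+)
import Data.Integer.Properties as ℤ
open import Data.Sum using (_⊎_; inj₁; inj₂; [_,_]′; fromInj₁)
open import Data.Empty using (⊥-elim)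
open import Function using (_∘_)
open import Function.Definitions using (Injective)
open import Relation.Binary.PropositionalEquality

funToFin-injective : ∀ {m n} {f g : Fin m → Fin n} → funToFin f ≡ funToFin g → ∀ i → f i ≡ g i
funToFin-injective {f = f} {g} eq i = begin
  f i                        ≡⟨ finToFun-funToFin f i ⟨
  Fin.finToFun (funToFin f) i ≡⟨ cong (λ x → Fin.finToFun x i) eq ⟩
  Fin.finToFun (funToFin g) i ≡⟨ finToFun-funToFin g i ⟩
  g i                        ∎
  where open ≡-Reasoning

pigeonhole-grid : ∀ {k m n L} → (k ^ n) ^ m < L → (f : Fin L → Fin m → Fin n → Fin k) →
                  ∃₂ λ i j → i Fin.< j × (∀ p q → f i p q ≡ f j p q)
pigeonhole-grid lt f with pigeonhole lt (λ i → funToFin (λ p → funToFin (f i p)))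
... | i , j , i<j , eq = i , j , i<j , λ p → funToFin-injective (funToFin-injective eq p)

GridColoring : ℕ → Set
GridColoring k = ℕ → ℕ → Fin k

translate : ∀ {k} → ℕ → ℕ → GridColoring k → GridColoring k
translate α β c p q = c (α + p) (β + q)

AgreeOn : ∀ {k} → ℕ → GridColoring k → GridColoring k → Set
AgreeOn n c c′ = ∀ p q → p < n → q < n → c p q ≡ c′ p q

agreeOn-Fin : ∀ {k n} {c c′ : GridColoring k} →
              (∀ (p q : Fin n) → c (toℕ p) (toℕ q) ≡ c′ (toℕ p) (toℕ q)) → AgreeOn n c c′
agreeOn-Fin {c = c} {c′} eq p q p<n q<n =
  subst₂ (λ u v → c u v ≡ c′ u v) (toℕ-fromℕ< p<n) (toℕ-fromℕ< q<n) (eq (fromℕ< p<n) (fromℕ< q<n))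

record Corner {k} (M : ℕ) (c : GridColoring k) : Set where
  field
    a b d : ℕ
    d>0 : 0 < d
    a+d<M : a + d < M
    b+d<M : b + d < M
    right : c (a + d) b ≡ c a b
    up : c a (b + d) ≡ c a b

record Focus {k} (r M : ℕ) (c : GridColoring k) : Set where
  field
    a b : ℕ
    spoke : Fin r → ℕ
    a<M : a < M
    b<M : b < M
    spoke>0 : ∀ i → 0 < spoke i
    a+spoke<M : ∀ i → a + spoke i < M
    b+spoke<M : ∀ i → b + spoke i < M
    balanced : ∀ i → c (a + spoke i) b ≡ c a (b + spoke i)
    distinct : Injective _≡_ _≡_ (λ i → c (a + spoke i) b)

Focus⇒≤ : ∀ {k r M} {c : GridColoring k} → Focus r M c → r ≤ k
Focus⇒≤ F = injective⇒≤ (Focus.distinct F)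

Corner-translate : ∀ {k M M′ α β} {c : GridColoring k} →
                   α + M ≤ M′ → β + M ≤ M′ → Corner M (translate α β c) → Corner M′ c
Corner-translate {M = M} {M′} {α} {β} {c} α-fits β-fits C = record
  { a = α + a ; b = β + b ; d = d ; d>0 = d>0
  ; a+d<M = shifted α-fits (+-assoc α a d) a+d<M
  ; b+d<M = shifted β-fits (+-assoc β b d) b+d<M
  ; right = trans (cong (λ u → c u (β + b)) (+-assoc α a d)) right
  ; up = trans (cong (c (α + a)) (+-assoc β b d)) up
  }
  where
  open Corner C
  shifted : ∀ {x u v} → x + M ≤ M′ → u ≡ x + v → v < M → u < M′
  shifted {x} fits refl v<M = <-≤-trans (+-monoʳ-< x v<M) fits

record IdenticalArms {k} (n M : ℕ) (c : GridColoring k) : Set where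
  field
    α β Δ : ℕ
    Δ>0 : 0 < Δ
    α-fits : α + Δ + n ≤ M
    β-fits : β + Δ + n ≤ M
    agree : AgreeOn n (translate (α + Δ) β c) (translate α (β + Δ) c)

module _ {k n M} {c : GridColoring k} (arms : IdenticalArms n M c) where
  open IdenticalArms arms

  arm : GridColoring k
  arm = translate (α + Δ) β c

  cornerInArm : Corner n arm → Corner M c
  cornerInArm = Corner-translate α-fits (≤-trans (+-monoˡ-≤ n (m≤m+n β Δ)) β-fits)

  module _ {r} (F : Focus r n arm) where
    open Focus F renaming (a to a₀; b to b₀; spoke to s; balanced to balanced₀; distinct to distinct₀)

    offset : Fin (suc r) → ℕ
    offset = 0 ∷ s

    offset<n : ∀ {x} → x < n → (∀ i → x + s i < n) → ∀ i → x + offset i < n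
    offset<n {x} x<n _ Fin.zero = subst (_< n) (sym (+-identityʳ x)) x<n
    offset<n _ x+s<n (Fin.suc i) = x+s<n i

    fits : ∀ {x y} → x + Δ + n ≤ M → y < n → x + Δ + y < M
    fits {x} x-fits y<n = <-≤-trans (+-monoʳ-< (x + Δ) y<n) x-fits

    start<M : ∀ {x y} → x + Δ + n ≤ M → y < n → x + y < M
    start<M {x} {y} x-fits y<n = ≤-<-trans (+-monoˡ-≤ y (m≤m+n x Δ)) (fits x-fits y<n)

    end<M : ∀ {x y} → x + Δ + n ≤ M → (∀ i → y + offset i < n) → ∀ i → x + y + (Δ + offset i) < M
    end<M {x} {y} x-fits y+o<n i = subst (_< M) (sym (interchange x y Δ (offset i))) (fits x-fits (y+o<n i))

    balancedOffset : ∀ i → arm (a₀ + offset i) b₀ ≡ arm a₀ (b₀ + offset i)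
    balancedOffset Fin.zero = cong₂ arm (+-identityʳ a₀) (sym (+-identityʳ b₀))
    balancedOffset (Fin.suc i) = balanced₀ i

    horizontal : ∀ i → c (α + a₀ + (Δ + offset i)) (β + b₀) ≡ arm (a₀ + offset i) b₀
    horizontal i = cong (λ u → c u (β + b₀)) (interchange α a₀ Δ (offset i))

    vertical : ∀ i → c (α + a₀) (β + b₀ + (Δ + offset i)) ≡ translate α (β + Δ) c a₀ (b₀ + offset i)
    vertical i = cong (c (α + a₀)) (interchange β b₀ Δ (offset i))

    b₀+offset<n : ∀ i → b₀ + offset i < n
    b₀+offset<n = offset<n b<M b+spoke<M

    module _ (apexFree : ¬ (∃[ i ] arm a₀ b₀ ≡ arm (a₀ + s i) b₀)) where

      distinctOffset : Injective _≡_ _≡_ (λ i → arm (a₀ + offset i) b₀)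
      distinctOffset {Fin.zero} {Fin.zero} _ = refl
      distinctOffset {Fin.zero} {Fin.suc j} eq =
        ⊥-elim (apexFree (j , trans (cong (λ u → arm u b₀) (sym (+-identityʳ a₀))) eq))
      distinctOffset {Fin.suc i} {Fin.zero} eq =
        ⊥-elim (apexFree (i , trans (cong (λ u → arm u b₀) (sym (+-identityʳ a₀))) (sym eq)))
      distinctOffset {Fin.suc i} {Fin.suc j} eq = cong Fin.suc (distinct₀ eq)

      -- The new apex sits in the corner box; spoke 0 joins the two copies of the old apex,
      -- and every old spoke is lengthened by Δ.
      addSpoke : Focus (suc r) M c
      addSpoke = record
        { a = α + a₀ ; b = β + b₀ ; spoke = λ i → Δ + offset i
        ; a<M = start<M α-fits a<M
        ; b<M = start<M β-fits b<M
        ; spoke>0 = λ i → <-≤-trans Δ>0 (m≤m+n Δ (offset i))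
        ; a+spoke<M = end<M α-fits (offset<n a<M a+spoke<M)
        ; b+spoke<M = end<M β-fits b₀+offset<n
        ; balanced = λ i → begin
            c (α + a₀ + (Δ + offset i)) (β + b₀)        ≡⟨ horizontal i ⟩
            arm (a₀ + offset i) b₀                      ≡⟨ balancedOffset i ⟩
            arm a₀ (b₀ + offset i)                      ≡⟨ agree a₀ (b₀ + offset i) a<M (b₀+offset<n i) ⟩
            translate α (β + Δ) c a₀ (b₀ + offset i)    ≡⟨ vertical i ⟨
            c (α + a₀) (β + b₀ + (Δ + offset i))        ∎
        ; distinct = λ {i} {j} eq → distinctOffset (trans (sym (horizontal i)) (trans eq (horizontal j)))
        }
        where open ≡-Reasoning

    extendFocus : Corner M c ⊎ Focus (suc r) M c
    extendFocus with any? (λ i → arm a₀ b₀ Fin.≟ arm (a₀ + s i) b₀)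
    ... | no apexFree = inj₂ (addSpoke apexFree)
    ... | yes (i , eq) = inj₁ (cornerInArm record
      { a = a₀ ; b = b₀ ; d = s i ; d>0 = spoke>0 i
      ; a+d<M = a+spoke<M i ; b+d<M = b+spoke<M i
      ; right = sym eq ; up = trans (sym (balanced₀ i)) (sym eq) })

module _ {k} (c : GridColoring k) (n K : ℕ) where

  antidiagonalBox : ℕ → GridColoring k
  antidiagonalBox u = translate (u * n) ((K ∸ u) * n) c

  box-fits : ∀ {u} → u ≤ K → u * n + n ≤ suc K * n
  box-fits {u} u≤K = subst (u * n + n ≤_) (+-comm (K * n) n) (+-monoˡ-≤ n (*-monoˡ-≤ n u≤K))

  repeatedBox⇒IdenticalArms : ∀ {x y} → 0 < n → x < y → y ≤ K →
                               AgreeOn n (antidiagonalBox y) (antidiagonalBox x) → IdenticalArms n (suc K * n) c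
  repeatedBox⇒IdenticalArms {x} {y} n>0 x<y y≤K same = record
    { α = x * n ; β = (K ∸ y) * n ; Δ = (y ∸ x) * n
    ; Δ>0 = *-mono-< (m<n⇒0<n∸m x<y) n>0
    ; α-fits = subst (λ u → u + n ≤ suc K * n) (sym α+Δ≡) (box-fits y≤K)
    ; β-fits = subst (λ u → u + n ≤ suc K * n) (sym β+Δ≡) (box-fits (m∸n≤m K x))
    ; agree = subst₂ (λ u v → AgreeOn n (translate u ((K ∸ y) * n) c) (translate (x * n) v c))
                     (sym α+Δ≡) (sym β+Δ≡) same
    }
    where
    open ≡-Reasoning
    x≤y = <⇒≤ x<y
    α+Δ≡ : x * n + (y ∸ x) * n ≡ y * n
    α+Δ≡ = trans (sym (*-distribʳ-+ n x (y ∸ x))) (cong (_* n) (m+[n∸m]≡n x≤y))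
    β+Δ≡ : (K ∸ y) * n + (y ∸ x) * n ≡ (K ∸ x) * n
    β+Δ≡ = begin
      (K ∸ y) * n + (y ∸ x) * n  ≡⟨ *-distribʳ-+ n (K ∸ y) (y ∸ x) ⟨
      (K ∸ y + (y ∸ x)) * n      ≡⟨ cong (_* n) (+-∸-assoc (K ∸ y) x≤y) ⟨
      (K ∸ y + y ∸ x) * n        ≡⟨ cong (λ u → (u ∸ x) * n) (m∸n+n≡m y≤K) ⟩
      (K ∸ x) * n                ∎

-- Pigeonhole over the (k ^ n) ^ n colorings of an n × n box, among K + 1 boxes on an antidiagonal.
identicalArms : ∀ {k} N (c : GridColoring k) →
                IdenticalArms (suc N) (suc ((k ^ suc N) ^ suc N) * suc N) c
identicalArms {k} N c =
  let i , j , i<j , same = pigeonhole-grid (n<1+n K) (λ u p q → antidiagonalBox c n K (toℕ u) (toℕ p) (toℕ q))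
  in repeatedBox⇒IdenticalArms c n K z<s i<j (s≤s⁻¹ (toℕ<n j)) (agreeOn-Fin (λ p q → sym (same p q)))
  where
  n = suc N
  K = (k ^ n) ^ n

CornerOrFocus : (k r M : ℕ) → Set
CornerOrFocus k r M = ∀ (c : GridColoring k) → Corner M c ⊎ Focus r M c

cornerOrFocus : ∀ k r → ∃[ N ] CornerOrFocus k r (suc N)
cornerOrFocus k zero = 0 , λ c → inj₂ record
  { a = 0 ; b = 0 ; spoke = λ () ; a<M = z<s ; b<M = z<s
  ; spoke>0 = λ () ; a+spoke<M = λ () ; b+spoke<M = λ () ; balanced = λ () ; distinct = λ { {()} } }
cornerOrFocus k (suc r) with cornerOrFocus k r
... | N , hyp = N + (k ^ suc N) ^ suc N * suc N , λ c →
  let arms = identicalArms N c in [ inj₁ ∘ cornerInArm arms , extendFocus arms ]′ (hyp (arm arms))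

monochromaticCorner : ∀ k → ∃[ M ] ∀ (c : GridColoring k) → Corner M c
monochromaticCorner k with cornerOrFocus k (suc k)
... | N , hyp = suc N , λ c → fromInj₁ (⊥-elim ∘ 1+n≰n ∘ Focus⇒≤) (hyp c)

Corner⇒¬Proper : ∀ {k M n} {c : Coloring k} → M + M ≤ n → Corner M (λ p q → c (+ p) (+ q)) → ¬ Proper n k c
Corner⇒¬Proper {M = M} {n} {c} M+M≤n C proper =
  proper (+ a) (+ b) (+ d) (+ 0) (λ (d≡0 , _) → <-irrefl (sym (ℤ.+-injective d≡0)) d>0)
    (inT (m≤m+n a d) (m≤m+n b d))
    (inT ≤-refl (+-monoʳ-≤ b z≤n))
    (inT (+-monoʳ-≤ a z≤n) (≤-reflexive (+-identityʳ (b + d))))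
    ( sym (trans (cong (c (+ (a + d)) ∘ +_) (+-identityʳ b)) right)
    , sym (trans (cong₂ (λ u v → c (+ u) (+ v)) (+-identityʳ a) (+-identityʳ (b + d))) up) )
  where
  open Corner C
  inT : ∀ {p q} → p ≤ a + d → q ≤ b + d → InT n (+ p) (+ q)
  inT p≤ q≤ = +≤+ z≤n , +≤+ z≤n , +<+ (<-≤-trans (≤-<-trans (+-mono-≤ p≤ q≤) (+-mono-< a+d<M b+d<M)) M+M≤n)

mainTheorem2 : (k : ℕ) → ∃[ N ] ((n : ℕ) → N ≤ n → ¬ (Σ (Coloring k) (λ c → Proper n k c)))
mainTheorem2 k with monochromaticCorner k
... | M , corner = M + M , λ n M+M≤n (c , proper) → Corner⇒¬Proper M+M≤n (corner (λ p q → c (+ p) (+ q))) proper
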